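{- Let $p$ be any prime and let $A\subseteq\mathbb F_p$ with $|A|\ge\lfloor p/3\rfloor+2$. Then every element of $\mathbb F_p$ can be written as $a_1+a_2+a_3$ with $a_1,a_2,a_3\in A$, $a_1\ne a_2$ and $a_2\ne a_3$.
   Context: $\mathbb F_p$ is the field with $p$ elements. -}

module Defs where

open import Data.Nat using (ℕ; suc; _+_)
open import Data.Fin using (Fin; toℕ)
open import Data.Nat.DivMod using (_mod_)

_+ₚ_ : {p : ℕ} → Fin p → Fin p → Fin p
_+ₚ_ {suc n} a b = (toℕ a + toℕ b) mod (suc n)
infixl 6 _+ₚ_

{-# OPTIONS --safe #-}
-- Cauchy–Davenport, |X + Y| ≥ min (p , |X| + |Y| - 1) in 𝔽ₚ, by induction on |Y| using Dyson's
-- e-transform (X , Y) ↦ (X ∪ (Y + e) , Y ∩ (X - e)); when no transform shrinks Y, X is invariant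
-- under a nonzero translation and is therefore all of 𝔽ₚ.
-- For p ≠ 3, 3u = x has at most one solution; removing it from A leaves A′ with |A′| ≥ |A| - 1,
-- and |A′| + |A′| + |A| ≥ 3|A| - 2 ≥ p + 2, so x = u + w + c with u, w ∈ A′ and c ∈ A. The three
-- summands are not all equal, and reordering them makes neighbours distinct.
-- For p = 3 the hypothesis forces A = 𝔽₃.
module Submission where

open import Defs
open import Algebra.Bundles using (Group)
open import Level using (0ℓ)
open import Data.Bool using (Bool; true; false; T; not; _∧_; _∨_)
open import Data.Empty using (⊥-elim)
open import Data.Fin using (Fin; zero; suc; toℕ; punchOut)
open import Data.Fin.Patterns using (0F; 1F; 2F)
open import Data.Fin.Properties using (toℕ-fromℕ<; toℕ-injective; toℕ<n; any?; pigeonhole; punchOut-injective; _≟_)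
open import Data.Fin.Subset using (Subset; _∈_; ∣_∣)
open import Data.Nat using (ℕ; zero; suc; _+_; _*_; _∸_; _≤_; _<_; _%_; _/_; s≤s; z≤n; _≤?_; NonZero)
open import Data.Nat.Base using (>-nonZero)
open import Data.Nat.DivMod using (_mod_; m%n<n; %-distribˡ-+; m%n%n≡m%n; m<n⇒m%n≡m; n%n≡0; m≡m%n+[m/n]*n)
open import Data.Nat.Divisibility using (_∣_; divides; ∣⇒≤)
open import Data.Nat.Primality using (Prime; euclidsLemma; ¬prime[0]; prime?; prime⇒irreducible; ¬prime[1])
open import Data.Nat.Properties hiding (_≟_)
open import Data.Nat.Properties using () renaming (_≟_ to _≟ℕ_)
open import Data.Nat.Tactic.RingSolver using (solve-∀)
open import Function.Base using (_∘_)
open import Data.Product using (∃; ∃-syntax; _×_; _,_; proj₁; proj₂)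
open import Data.Sum using (_⊎_; inj₁; inj₂)
open import Data.Unit using (tt)
open import Data.Vec using (_∷_; []; lookup)
open import Data.Vec.Properties using (lookup⇒[]=)
open import Data.Fin.Permutation using (permutation)
open import Algebra.Properties.CommutativeMonoid.Sum +-0-commutativeMonoid using (sum; sum-permute; sum-cong-≗)
open import Algebra.Properties.CommutativeSemigroup +-commutativeSemigroup using (interchange)
open import Relation.Binary.PropositionalEquality
open import Relation.Binary using (tri<; tri≈; tri>)
open import Data.Bool.Properties using (T-∧; T-∨; ∧-comm)
open import Function.Bundles using (Equivalence)
open Equivalence using (to; from)
open import Relation.Nullary using (Dec; yes; no; does; ¬_)
open import Relation.Nullary.Decidable using (T?; ¬?; _×-dec_; isYes; toWitness; fromWitness; decidable-stable)

module Counting where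

  indicator : Bool → ℕ
  indicator true  = 1
  indicator false = 0

  ⁅_⁆ : ∀ {m} → Fin m → Fin m → Bool
  ⁅ a ⁆ i = does (i ≟ a)

  ∈⁅⁆ : ∀ {m} (a : Fin m) → T (⁅ a ⁆ a)
  ∈⁅⁆ a with a ≟ a
  ... | yes _   = tt
  ... | no  a≢a = a≢a refl

  ∈⁅⁆⇒≡ : ∀ {m} (a i : Fin m) → T (⁅ a ⁆ i) → i ≡ a
  ∈⁅⁆⇒≡ a i i∈⁅a⁆ with i ≟ a
  ... | yes i≡a = i≡a

  ∉⁅⁆⇒≢ : ∀ {m} (a i : Fin m) → T (not (⁅ a ⁆ i)) → i ≢ a
  ∉⁅⁆⇒≢ a i i∉⁅a⁆ with i ≟ a
  ... | no i≢a = i≢a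

  opaque
    card : ∀ {m} → (Fin m → Bool) → ℕ
    card X = sum (λ i → indicator (X i))

    card-cong : ∀ {m} {X Y : Fin m → Bool} → (∀ i → X i ≡ Y i) → card X ≡ card Y
    card-cong X≗Y = sum-cong-≗ (λ i → cong indicator (X≗Y i))

    card-mono : ∀ {m} {X Y : Fin m → Bool} → (∀ i → T (X i) → T (Y i)) → card X ≤ card Y
    card-mono {zero}  X⊆Y = z≤n
    card-mono {suc m} {X} {Y} X⊆Y = +-mono-≤ (indicator-mono (X zero) (Y zero) (X⊆Y zero)) (card-mono (λ i → X⊆Y (suc i)))
      where
      indicator-mono : ∀ x y → (T x → T y) → indicator x ≤ indicator y
      indicator-mono false y     _ = z≤n
      indicator-mono true  true  _ = ≤-refl
      indicator-mono true  false f = ⊥-elim (f tt)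

    card-split : ∀ {m} (X Y : Fin m → Bool) → card X ≡ card (λ i → X i ∧ Y i) + card (λ i → X i ∧ not (Y i))
    card-split {zero}  X Y = refl
    card-split {suc m} X Y = trans
      (cong₂ _+_ (indicator-split (X zero) (Y zero)) (card-split (λ i → X (suc i)) (λ i → Y (suc i))))
      (interchange (indicator (X zero ∧ Y zero)) _ _ _)
      where
      indicator-split : ∀ x y → indicator x ≡ indicator (x ∧ y) + indicator (x ∧ not y)
      indicator-split false y     = refl
      indicator-split true  true  = refl
      indicator-split true  false = refl

    card-∨+card-∧ : ∀ {m} (X Y : Fin m → Bool) → card (λ i → X i ∨ Y i) + card (λ i → X i ∧ Y i) ≡ card X + card Y
    card-∨+card-∧ {zero}  X Y = refl
    card-∨+card-∧ {suc m} X Y = begin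
      (indicator (X zero ∨ Y zero) + card (λ i → X (suc i) ∨ Y (suc i))) + (indicator (X zero ∧ Y zero) + card (λ i → X (suc i) ∧ Y (suc i)))
        ≡⟨ interchange (indicator (X zero ∨ Y zero)) _ _ _ ⟩
      (indicator (X zero ∨ Y zero) + indicator (X zero ∧ Y zero)) + (card (λ i → X (suc i) ∨ Y (suc i)) + card (λ i → X (suc i) ∧ Y (suc i)))
        ≡⟨ cong₂ _+_ (indicator-∨+∧ (X zero) (Y zero)) (card-∨+card-∧ (λ i → X (suc i)) (λ i → Y (suc i))) ⟩
      (indicator (X zero) + indicator (Y zero)) + (card (λ i → X (suc i)) + card (λ i → Y (suc i)))
        ≡⟨ interchange (indicator (X zero)) _ _ _ ⟩
      (indicator (X zero) + card (λ i → X (suc i))) + (indicator (Y zero) + card (λ i → Y (suc i))) ∎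
      where
      open ≡-Reasoning
      indicator-∨+∧ : ∀ x y → indicator (x ∨ y) + indicator (x ∧ y) ≡ indicator x + indicator y
      indicator-∨+∧ false false = refl
      indicator-∨+∧ false true  = refl
      indicator-∨+∧ true  false = refl
      indicator-∨+∧ true  true  = refl

    card+card-not : ∀ {m} (X : Fin m → Bool) → card X + card (λ i → not (X i)) ≡ m
    card+card-not {zero}  X = refl
    card+card-not {suc m} X = trans (interchange (indicator (X zero)) _ _ _)
      (cong₂ _+_ (indicator+indicator-not (X zero)) (card+card-not (λ i → X (suc i))))
      where
      indicator+indicator-not : ∀ x → indicator x + indicator (not x) ≡ 1
      indicator+indicator-not false = refl
      indicator+indicator-not true  = refl

    card-⁅⁆ : ∀ {m} (a : Fin m) → card ⁅ a ⁆ ≡ 1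
    card-⁅⁆ {suc m} zero    = cong suc (card-⁅zero⁆-tail m)
      where
      card-⁅zero⁆-tail : ∀ k → sum {k} (λ i → indicator (⁅_⁆ {suc k} zero (suc i))) ≡ 0
      card-⁅zero⁆-tail zero    = refl
      card-⁅zero⁆-tail (suc k) = card-⁅zero⁆-tail k
    card-⁅⁆ {suc m} (suc a) = card-⁅⁆ a

    card-const-true : ∀ {m} → card {m} (λ _ → true) ≡ m
    card-const-true {zero}  = refl
    card-const-true {suc m} = cong suc (card-const-true {m})

    card-∘-inverse : ∀ {m} (X : Fin m → Bool) (f g : Fin m → Fin m) → (∀ x → f (g x) ≡ x) → (∀ x → g (f x) ≡ x) →
                     card (λ i → X (f i)) ≡ card X
    card-∘-inverse X f g f∘g g∘f = sym (sum-permute (λ i → indicator (X i)) (permutation f g f∘g g∘f))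

    ∣A∣≡card : ∀ {m} (A : Subset m) → ∣ A ∣ ≡ card (lookup A)
    ∣A∣≡card []          = refl
    ∣A∣≡card (true ∷ A)  = cong suc (∣A∣≡card A)
    ∣A∣≡card (false ∷ A) = ∣A∣≡card A

    T⇒1≤card : ∀ {m} (X : Fin m → Bool) z → T (X z) → 1 ≤ card X
    T⇒1≤card {suc m} X zero    h with X zero
    ... | true = s≤s z≤n
    T⇒1≤card {suc m} X (suc z) h = ≤-trans (T⇒1≤card (λ i → X (suc i)) z h) (m≤n+m _ (indicator (X zero)))

    1≤card⇒∃ : ∀ {m} (X : Fin m → Bool) → 1 ≤ card X → ∃ λ z → T (X z)
    1≤card⇒∃ {suc m} X h with X zero in eq
    ... | true  = zero , subst T (sym eq) tt
    ... | false with 1≤card⇒∃ (λ i → X (suc i)) h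
    ...   | z , Xz = suc z , Xz

  lookup⇒∈ : ∀ {m} (A : Subset m) a → T (lookup A a) → a ∈ A
  lookup⇒∈ A a h = lookup⇒[]= a A (T⇒≡true (lookup A a) h)
    where
    T⇒≡true : ∀ b → T b → b ≡ true
    T⇒≡true true _ = refl

  all⇒m≤card : ∀ {m} (X : Fin m → Bool) → (∀ z → T (X z)) → m ≤ card X
  all⇒m≤card X all = subst (_≤ card X) card-const-true (card-mono (λ i _ → all i))

  m≤card⇒all : ∀ {m} (X : Fin m → Bool) → m ≤ card X → ∀ z → T (X z)
  m≤card⇒all {m} X m≤card z with X z in eq
  ... | true  = tt
  ... | false = ⊥-elim (<⇒≱ card<m m≤card)
    where
    card<m : card X < m
    card<m = begin-strict
      card X                                ≡⟨ +-identityʳ (card X) ⟨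
      card X + 0                            <⟨ +-monoʳ-< (card X) (T⇒1≤card (λ i → not (X i)) z (subst (λ b → T (not b)) (sym eq) tt)) ⟩
      card X + card (λ i → not (X i))       ≡⟨ card+card-not X ⟩
      m                                     ∎
      where open ≤-Reasoning

  card≤1 : ∀ {m} (X : Fin m → Bool) → (∀ u v → T (X u) → T (X v) → u ≡ v) → card X ≤ 1
  card≤1 X unique with 1 ≤? card X
  ... | no  ¬1≤card = <⇒≤ (≰⇒> ¬1≤card)
  ... | yes 1≤card with 1≤card⇒∃ X 1≤card
  ...   | a , Xa = subst (card X ≤_) (card-⁅⁆ a) (card-mono λ i Xi → subst (λ j → T (⁅ a ⁆ j)) (sym (unique i a Xi Xa)) (∈⁅⁆ a))

  card≤1+card-∖ : ∀ {m} (X Y : Fin m → Bool) → (∀ u v → T (Y u) → T (Y v) → u ≡ v) →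
                  card X ≤ suc (card (λ i → X i ∧ not (Y i)))
  card≤1+card-∖ X Y unique = begin
    card X                                                     ≡⟨ card-split X Y ⟩
    card (λ i → X i ∧ Y i) + card (λ i → X i ∧ not (Y i))      ≤⟨ +-monoˡ-≤ _ (card≤1 _ λ u v XYu XYv → unique u v (proj₂ (to T-∧ XYu)) (proj₂ (to T-∧ XYv))) ⟩
    suc (card (λ i → X i ∧ not (Y i)))                         ∎
    where open ≤-Reasoning

  2≤card⇒distinct : ∀ {m} (X : Fin m → Bool) → 2 ≤ card X → ∃[ b ] ∃[ b′ ] (T (X b) × T (X b′) × b′ ≢ b)
  2≤card⇒distinct X 2≤card with 1≤card⇒∃ X (≤-trans (s≤s z≤n) 2≤card)
  ... | b , Xb with 1≤card⇒∃ _ (≤-pred (≤-trans 2≤card (card≤1+card-∖ X ⁅ b ⁆ λ u v u≡b v≡b → trans (∈⁅⁆⇒≡ b u u≡b) (sym (∈⁅⁆⇒≡ b v v≡b)))))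
  ...   | b′ , b′∈X∖⁅b⁆ = b , b′ , Xb , proj₁ (to T-∧ b′∈X∖⁅b⁆) , ∉⁅⁆⇒≢ b b′ (proj₂ (to T-∧ b′∈X∖⁅b⁆))

[m%d+n]%d≡[m+n]%d : ∀ m n d .{{_ : NonZero d}} → (m % d + n) % d ≡ (m + n) % d
[m%d+n]%d≡[m+n]%d m n d = begin
  (m % d + n) % d            ≡⟨ %-distribˡ-+ (m % d) n d ⟩
  (m % d % d + n % d) % d    ≡⟨ cong (λ t → (t + n % d) % d) (m%n%n≡m%n m d) ⟩
  (m % d + n % d) % d        ≡⟨ %-distribˡ-+ m n d ⟨
  (m + n) % d                ∎
  where open ≡-Reasoning

[m+n%d]%d≡[m+n]%d : ∀ m n d .{{_ : NonZero d}} → (m + n % d) % d ≡ (m + n) % d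
[m+n%d]%d≡[m+n]%d m n d = begin
  (m + n % d) % d   ≡⟨ cong (_% d) (+-comm m (n % d)) ⟩
  (n % d + m) % d   ≡⟨ [m%d+n]%d≡[m+n]%d n m d ⟩
  (n + m) % d       ≡⟨ cong (_% d) (+-comm n m) ⟩
  (m + n) % d       ∎
  where open ≡-Reasoning

m%d≡[m+o]%d⇒d∣o : ∀ m o d .{{_ : NonZero d}} → m % d ≡ (m + o) % d → d ∣ o
m%d≡[m+o]%d⇒d∣o m o d eq = divides ((m + o) / d ∸ m / d) (begin
  o                                                   ≡⟨ m+n∸m≡n m o ⟨
  (m + o) ∸ m                                         ≡⟨ cong₂ _∸_ (m≡m%n+[m/n]*n (m + o) d) (m≡m%n+[m/n]*n m d) ⟩
  ((m + o) % d + (m + o) / d * d) ∸ (m % d + m / d * d) ≡⟨ cong (λ t → (t + (m + o) / d * d) ∸ (m % d + m / d * d)) eq ⟨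
  (m % d + (m + o) / d * d) ∸ (m % d + m / d * d)       ≡⟨ [m+n]∸[m+o]≡n∸o (m % d) _ _ ⟩
  (m + o) / d * d ∸ m / d * d                         ≡⟨ *-distribʳ-∸ d ((m + o) / d) (m / d) ⟨
  ((m + o) / d ∸ m / d) * d                           ∎)
  where open ≡-Reasoning

-- The two residues differ by k (y - x) with 0 < y - x < p, so Euclid's lemma leaves only p ∣ k.
[m+kx]%p≡[m+ky]%p⇒p∣k : ∀ {n} → Prime (suc n) → ∀ m k {x y} → x < y → y < suc n →
                         (m + k * x) % suc n ≡ (m + k * y) % suc n → suc n ∣ k
[m+kx]%p≡[m+ky]%p⇒p∣k {n} p-prime m k {x} {y} x<y y<p eq
  with euclidsLemma k (y ∸ x) p-prime (m%d≡[m+o]%d⇒d∣o (m + k * x) (k * (y ∸ x)) (suc n) (trans eq (cong (_% suc n) split)))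
  where
  split : m + k * y ≡ (m + k * x) + k * (y ∸ x)
  split = begin
    m + k * y                 ≡⟨ cong (λ t → m + k * t) (m+[n∸m]≡n (<⇒≤ x<y)) ⟨
    m + k * (x + (y ∸ x))     ≡⟨ cong (m +_) (*-distribˡ-+ k x (y ∸ x)) ⟩
    m + (k * x + k * (y ∸ x)) ≡⟨ +-assoc m _ _ ⟨
    (m + k * x) + k * (y ∸ x) ∎
    where open ≡-Reasoning
... | inj₁ p∣k   = p∣k
... | inj₂ p∣y-x = ⊥-elim (<⇒≱ (≤-<-trans (m∸n≤m y x) y<p) (∣⇒≤ {{>-nonZero (m<n⇒0<n∸m x<y)}} p∣y-x))

p∣3⇒p≡3 : ∀ {p} → Prime p → p ∣ 3 → p ≡ 3
p∣3⇒p≡3 p-prime p∣3 with prime⇒irreducible (toWitness {a? = prime? 3} tt) p∣3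
... | inj₁ refl = ⊥-elim (¬prime[1] p-prime)
... | inj₂ p≡3  = p≡3

m+m+m≡3*m : ∀ m → m + m + m ≡ 3 * m
m+m+m≡3*m = solve-∀

floor-third-bound : ∀ p k c → p / 3 + 2 ≤ k → k ≤ suc c → p + 2 ≤ c + c + k
floor-third-bound p k c large k≤1+c = +-cancelˡ-≤ 2 _ _ (begin
  2 + (p + 2)                   ≡⟨ cong (λ t → 2 + (t + 2)) (m≡m%n+[m/n]*n p 3) ⟩
  2 + (p % 3 + p / 3 * 3 + 2)   ≤⟨ +-monoʳ-≤ 2 (+-monoˡ-≤ 2 (+-monoˡ-≤ (p / 3 * 3) (≤-pred (m%n<n p 3)))) ⟩
  2 + (2 + p / 3 * 3 + 2)       ≡⟨ regroup₁ (p / 3) ⟩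
  3 * (p / 3 + 2)               ≤⟨ *-monoʳ-≤ 3 large ⟩
  3 * k                         ≡⟨ m+m+m≡3*m k ⟨
  k + k + k                     ≤⟨ +-monoˡ-≤ k (+-mono-≤ k≤1+c k≤1+c) ⟩
  suc c + suc c + k             ≡⟨ regroup₃ c k ⟩
  2 + (c + c + k)               ∎)
  where
  open ≤-Reasoning
  regroup₁ : ∀ q → 2 + (2 + q * 3 + 2) ≡ 3 * (q + 2)
  regroup₁ = solve-∀
  regroup₃ : ∀ c k → suc c + suc c + k ≡ 2 + (c + c + k)
  regroup₃ = solve-∀

module ZMod (n : ℕ) where

  P : ℕ
  P = suc n

  F : Set
  F = Fin P

  -ₚ_ : F → F
  -ₚ a = (P ∸ toℕ a) mod P

  infixl 6 _-ₚ_
  _-ₚ_ : F → F → F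
  a -ₚ b = a +ₚ (-ₚ b)

  toℕ-+ₚ : ∀ (a b : F) → toℕ (a +ₚ b) ≡ (toℕ a + toℕ b) % P
  toℕ-+ₚ a b = toℕ-fromℕ< (m%n<n (toℕ a + toℕ b) P)

  toℕ%P≡toℕ : ∀ (a : F) → toℕ a % P ≡ toℕ a
  toℕ%P≡toℕ a = m<n⇒m%n≡m (toℕ<n a)

  +ₚ-comm : ∀ (a b : F) → a +ₚ b ≡ b +ₚ a
  +ₚ-comm a b = cong (_mod P) (+-comm (toℕ a) (toℕ b))

  +ₚ-assoc : ∀ (a b c : F) → (a +ₚ b) +ₚ c ≡ a +ₚ (b +ₚ c)
  +ₚ-assoc a b c = toℕ-injective (begin
    toℕ ((a +ₚ b) +ₚ c)                 ≡⟨ toℕ-+ₚ (a +ₚ b) c ⟩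
    (toℕ (a +ₚ b) + toℕ c) % P          ≡⟨ cong (λ t → (t + toℕ c) % P) (toℕ-+ₚ a b) ⟩
    ((toℕ a + toℕ b) % P + toℕ c) % P   ≡⟨ [m%d+n]%d≡[m+n]%d (toℕ a + toℕ b) (toℕ c) P ⟩
    (toℕ a + toℕ b + toℕ c) % P         ≡⟨ cong (_% P) (+-assoc (toℕ a) _ _) ⟩
    (toℕ a + (toℕ b + toℕ c)) % P       ≡⟨ [m+n%d]%d≡[m+n]%d (toℕ a) (toℕ b + toℕ c) P ⟨
    (toℕ a + (toℕ b + toℕ c) % P) % P   ≡⟨ cong (λ t → (toℕ a + t) % P) (toℕ-+ₚ b c) ⟨
    (toℕ a + toℕ (b +ₚ c)) % P          ≡⟨ toℕ-+ₚ a (b +ₚ c) ⟨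
    toℕ (a +ₚ (b +ₚ c))                 ∎)
    where open ≡-Reasoning

  +ₚ-identityʳ : ∀ (a : F) → a +ₚ zero ≡ a
  +ₚ-identityʳ a = toℕ-injective (trans (toℕ-+ₚ a zero) (trans (cong (_% P) (+-identityʳ (toℕ a))) (toℕ%P≡toℕ a)))

  +ₚ-identityˡ : ∀ (a : F) → zero +ₚ a ≡ a
  +ₚ-identityˡ a = trans (+ₚ-comm zero a) (+ₚ-identityʳ a)

  +ₚ-inverseʳ : ∀ (a : F) → a -ₚ a ≡ zero
  +ₚ-inverseʳ a = toℕ-injective (begin
    toℕ (a +ₚ (-ₚ a))                    ≡⟨ toℕ-+ₚ a (-ₚ a) ⟩
    (toℕ a + toℕ (-ₚ a)) % P             ≡⟨ cong (λ t → (toℕ a + t) % P) (toℕ-fromℕ< (m%n<n (P ∸ toℕ a) P)) ⟩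
    (toℕ a + (P ∸ toℕ a) % P) % P        ≡⟨ [m+n%d]%d≡[m+n]%d (toℕ a) (P ∸ toℕ a) P ⟩
    (toℕ a + (P ∸ toℕ a)) % P            ≡⟨ cong (_% P) (m+[n∸m]≡n (<⇒≤ (toℕ<n a))) ⟩
    P % P                                ≡⟨ n%n≡0 P ⟩
    0                                    ∎)
    where open ≡-Reasoning

  +ₚ-inverseˡ : ∀ (a : F) → (-ₚ a) +ₚ a ≡ zero
  +ₚ-inverseˡ a = trans (+ₚ-comm (-ₚ a) a) (+ₚ-inverseʳ a)

  +ₚ-group : Group 0ℓ 0ℓ
  +ₚ-group = record
    { Carrier = F ; _≈_ = _≡_ ; _∙_ = _+ₚ_ ; ε = zero ; _⁻¹ = (-ₚ_)
    ; isGroup = record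
      { isMonoid = record
        { isSemigroup = record
          { isMagma = record { isEquivalence = isEquivalence ; ∙-cong = cong₂ _+ₚ_ }
          ; assoc = +ₚ-assoc }
        ; identity = +ₚ-identityˡ , +ₚ-identityʳ }
      ; inverse = +ₚ-inverseˡ , +ₚ-inverseʳ
      ; ⁻¹-cong = cong (-ₚ_) } }

  open import Algebra.Properties.Group +ₚ-group using (//-rightDividesˡ; //-rightDividesʳ; x∙y⁻¹≈ε⇒x≈y)

  [x-y]+y≡x : ∀ (x y : F) → (x -ₚ y) +ₚ y ≡ x
  [x-y]+y≡x x y = //-rightDividesˡ y x

  [x+y]-y≡x : ∀ (x y : F) → (x +ₚ y) -ₚ y ≡ x
  [x+y]-y≡x x y = //-rightDividesʳ y x

  x-y≡0⇒x≡y : ∀ (x y : F) → x -ₚ y ≡ zero → x ≡ y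
  x-y≡0⇒x≡y = x∙y⁻¹≈ε⇒x≈y

  [y+e]+[x-e]≡x+y : ∀ (x y e : F) → (y +ₚ e) +ₚ (x -ₚ e) ≡ x +ₚ y
  [y+e]+[x-e]≡x+y x y e = begin
    (y +ₚ e) +ₚ (x -ₚ e)   ≡⟨ +ₚ-assoc y e (x -ₚ e) ⟩
    y +ₚ (e +ₚ (x -ₚ e))   ≡⟨ cong (y +ₚ_) (+ₚ-comm e (x -ₚ e)) ⟩
    y +ₚ ((x -ₚ e) +ₚ e)   ≡⟨ cong (y +ₚ_) ([x-y]+y≡x x e) ⟩
    y +ₚ x                 ≡⟨ +ₚ-comm y x ⟩
    x +ₚ y                 ∎
    where open ≡-Reasoning

  [a-b]+c≡a+[c-b] : ∀ (a b c : F) → (a -ₚ b) +ₚ c ≡ a +ₚ (c -ₚ b)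
  [a-b]+c≡a+[c-b] a b c = trans (+ₚ-assoc a (-ₚ b) c) (cong (a +ₚ_) (+ₚ-comm (-ₚ b) c))

  progression : F → F → ℕ → F
  progression a d zero    = a
  progression a d (suc j) = progression a d j +ₚ d

  toℕ-progression : ∀ a d j → toℕ (progression a d j) ≡ (toℕ a + toℕ d * j) % P
  toℕ-progression a d zero = begin
    toℕ a                 ≡⟨ toℕ%P≡toℕ a ⟨
    toℕ a % P             ≡⟨ cong (_% P) (trans (cong (toℕ a +_) (*-zeroʳ (toℕ d))) (+-identityʳ (toℕ a))) ⟨
    (toℕ a + toℕ d * 0) % P ∎
    where open ≡-Reasoning
  toℕ-progression a d (suc j) = begin
    toℕ (progression a d j +ₚ d)                ≡⟨ toℕ-+ₚ (progression a d j) d ⟩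
    (toℕ (progression a d j) + toℕ d) % P       ≡⟨ cong (λ t → (t + toℕ d) % P) (toℕ-progression a d j) ⟩
    ((toℕ a + toℕ d * j) % P + toℕ d) % P       ≡⟨ [m%d+n]%d≡[m+n]%d (toℕ a + toℕ d * j) (toℕ d) P ⟩
    (toℕ a + toℕ d * j + toℕ d) % P             ≡⟨ cong (_% P) (+-assoc (toℕ a) _ _) ⟩
    (toℕ a + (toℕ d * j + toℕ d)) % P           ≡⟨ cong (λ t → (toℕ a + t) % P) (trans (+-comm _ (toℕ d)) (sym (*-suc (toℕ d) j))) ⟩
    (toℕ a + toℕ d * suc j) % P                 ∎
    where open ≡-Reasoning

  module _ (p-prime : Prime P) where

    progression-injective : ∀ a {d} → d ≢ zero → ∀ {i j} → i < j → j < P → progression a d i ≢ progression a d j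
    progression-injective a {d} d≢0 {i} {j} i<j j<P eq = <⇒≱ (toℕ<n d) (∣⇒≤ {{>-nonZero (0<toℕ d d≢0)}} P∣d)
      where
      0<toℕ : ∀ (d : F) → d ≢ zero → 0 < toℕ d
      0<toℕ zero    d≢0 = ⊥-elim (d≢0 refl)
      0<toℕ (suc d) _   = s≤s z≤n
      P∣d : P ∣ toℕ d
      P∣d = [m+kx]%p≡[m+ky]%p⇒p∣k p-prime (toℕ a) (toℕ d) i<j j<P
              (trans (sym (toℕ-progression a d i)) (trans (cong toℕ eq) (toℕ-progression a d j)))

    -- The first P terms are pairwise distinct, so by pigeonhole they exhaust Fin P.
    progression-surjective : ∀ a {d} → d ≢ zero → ∀ z → ∃ λ (j : F) → progression a d (toℕ j) ≡ z
    progression-surjective a {d} d≢0 z with any? (λ j → progression a d (toℕ j) ≟ z)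
    ... | yes hit = hit
    ... | no miss with pigeonhole (n<1+n n) (λ j → punchOut {i = z} (miss-at j))
      where
      miss-at : ∀ (j : F) → z ≢ progression a d (toℕ j)
      miss-at j eq = miss (j , sym eq)
    ... | i , j , i<j , eq = ⊥-elim (progression-injective a d≢0 i<j (toℕ<n j)
                               (punchOut-injective (λ eq → miss (i , sym eq)) (λ eq → miss (j , sym eq)) eq))

    translation-closed⇒all : (X : F → Bool) → ∀ {d} → d ≢ zero → (∀ a → T (X a) → T (X (a +ₚ d))) →
                             ∀ {a} → T (X a) → ∀ z → T (X z)
    translation-closed⇒all X {d} d≢0 closed {a} Xa z with progression-surjective a d≢0 z
    ... | j , eq = subst (λ t → T (X t)) eq (progression-∈ (toℕ j))
      where
      progression-∈ : ∀ j → T (X (progression a d j))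
      progression-∈ zero    = Xa
      progression-∈ (suc j) = closed _ (progression-∈ j)

module Sumset (n : ℕ) (p-prime : Prime (suc n)) where

  open ZMod n
  open Counting

  opaque
    _⊞_ : (F → Bool) → (F → Bool) → F → Bool
    (X ⊞ Y) z = isYes (any? λ y → T? (Y y ∧ X (z -ₚ y)))

    ⊞-intro : ∀ X Y {x y} → T (X x) → T (Y y) → T ((X ⊞ Y) (x +ₚ y))
    ⊞-intro X Y {x} {y} Xx Yy = fromWitness (y , from T-∧ (Yy , subst (λ t → T (X t)) (sym ([x+y]-y≡x x y)) Xx))

    ⊞-elim : ∀ X Y {z} → T ((X ⊞ Y) z) → ∃[ x ] ∃[ y ] (T (X x) × T (Y y) × x +ₚ y ≡ z)
    ⊞-elim X Y {z} z∈X⊞Y with toWitness z∈X⊞Y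
    ... | y , YX with to T-∧ YX
    ...   | Yy , Xz-y = z -ₚ y , y , Xz-y , Yy , [x-y]+y≡x z y

  card≤card-⊞ : ∀ X Y {y} → T (Y y) → card X ≤ card (X ⊞ Y)
  card≤card-⊞ X Y {y} Yy = begin
    card X                      ≡⟨ card-∘-inverse X (_-ₚ y) (_+ₚ y) (λ x → [x+y]-y≡x x y) (λ x → [x-y]+y≡x x y) ⟨
    card (λ z → X (z -ₚ y))     ≤⟨ card-mono (λ z Xz-y → subst (λ t → T ((X ⊞ Y) t)) ([x-y]+y≡x z y) (⊞-intro X Y Xz-y Yy)) ⟩
    card (X ⊞ Y)                ∎
    where open ≤-Reasoning

  -- |X + Y| ≥ min (p , |X| + |Y| - 1), stated without truncated subtraction.
  CauchyDavenportBound : (F → Bool) → (F → Bool) → Set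
  CauchyDavenportBound X Y = card X + card Y ≤ suc (card (X ⊞ Y)) ⊎ P ≤ card (X ⊞ Y)

  module DysonTransform (X Y : F → Bool) (e : F) where

    X′ Y′ : F → Bool
    X′ z = X z ∨ Y (z -ₚ e)
    Y′ z = Y z ∧ X (z +ₚ e)

    X′⊞Y′⊆X⊞Y : ∀ z → T ((X′ ⊞ Y′) z) → T ((X ⊞ Y) z)
    X′⊞Y′⊆X⊞Y z z∈X′⊞Y′ with ⊞-elim X′ Y′ z∈X′⊞Y′
    ... | x , y , X′x , Y′y , x+y≡z with to T-∧ Y′y | to T-∨ X′x
    ...   | Yy , Xy+e | inj₁ Xx    = subst (λ t → T ((X ⊞ Y) t)) x+y≡z (⊞-intro X Y Xx Yy)
    ...   | Yy , Xy+e | inj₂ Yx-e  = subst (λ t → T ((X ⊞ Y) t)) (trans ([y+e]+[x-e]≡x+y x y e) x+y≡z) (⊞-intro X Y Xy+e Yx-e)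

    card-X′+card-Y′ : card X′ + card Y′ ≡ card X + card Y
    card-X′+card-Y′ = begin
      card X′ + card Y′                                       ≡⟨ cong (card X′ +_) X∩[Y+e]≅Y′ ⟨
      card X′ + card (λ z → X z ∧ Y (z -ₚ e))                 ≡⟨ card-∨+card-∧ X (λ z → Y (z -ₚ e)) ⟩
      card X + card (λ z → Y (z -ₚ e))                        ≡⟨ cong (card X +_) (card-∘-inverse Y (_-ₚ e) (_+ₚ e) (λ x → [x+y]-y≡x x e) (λ x → [x-y]+y≡x x e)) ⟩
      card X + card Y                                         ∎
      where
      open ≡-Reasoning
      X∩[Y+e]≅Y′ : card (λ z → X z ∧ Y (z -ₚ e)) ≡ card Y′
      X∩[Y+e]≅Y′ = trans (sym (card-∘-inverse _ (_+ₚ e) (_-ₚ e) (λ x → [x-y]+y≡x x e) (λ x → [x+y]-y≡x x e)))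
                         (card-cong λ w → trans (cong (λ t → X (w +ₚ e) ∧ Y t) ([x+y]-y≡x w e)) (∧-comm (X (w +ₚ e)) (Y w)))

    card-Y′<card-Y : ∀ {b} → T (Y b) → ¬ T (X (b +ₚ e)) → card Y′ < card Y
    card-Y′<card-Y {b} Yb ¬Xb+e = begin-strict
      card Y′                                        ≡⟨ +-identityʳ (card Y′) ⟨
      card Y′ + 0                                    <⟨ +-monoʳ-< (card Y′) (T⇒1≤card _ b (from T-∧ (Yb , ¬T⇒T-not ¬Xb+e))) ⟩
      card Y′ + card (λ z → Y z ∧ not (X (z +ₚ e)))  ≡⟨ card-split Y (λ z → X (z +ₚ e)) ⟨
      card Y                                         ∎
      where
      open ≤-Reasoning
      ¬T⇒T-not : ∀ {x} → ¬ T x → T (not x)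
      ¬T⇒T-not {false} _  = tt
      ¬T⇒T-not {true}  ¬t = ¬t tt

    bound-transfer : CauchyDavenportBound X′ Y′ → CauchyDavenportBound X Y
    bound-transfer (inj₁ bound) = inj₁ (subst (_≤ suc (card (X ⊞ Y))) card-X′+card-Y′ (≤-trans bound (s≤s (card-mono X′⊞Y′⊆X⊞Y))))
    bound-transfer (inj₂ bound) = inj₂ (≤-trans bound (card-mono X′⊞Y′⊆X⊞Y))

  DysonWitness : (F → Bool) → (F → Bool) → Set
  DysonWitness X Y = ∃[ a ] ∃[ b ] ∃[ b′ ] (T (X a) × T (Y b) × T (Y b′) × ¬ T (X ((a -ₚ b) +ₚ b′)))

  dysonWitness? : ∀ X Y → Dec (DysonWitness X Y)
  dysonWitness? X Y = any? λ a → any? λ b → any? λ b′ →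
    T? (X a) ×-dec T? (Y b) ×-dec T? (Y b′) ×-dec ¬? (T? (X ((a -ₚ b) +ₚ b′)))

  -- Without a witness, X is closed under translation by b′ - b for any two distinct b, b′ ∈ Y.
  ¬DysonWitness⇒all : ∀ X Y → 1 ≤ card X → 2 ≤ card Y → ¬ DysonWitness X Y → ∀ z → T (X z)
  ¬DysonWitness⇒all X Y 1≤|X| 2≤|Y| none with 2≤card⇒distinct Y 2≤|Y| | 1≤card⇒∃ X 1≤|X|
  ... | b , b′ , Yb , Yb′ , b′≢b | a , Xa =
    translation-closed⇒all p-prime X (λ b′-b≡0 → b′≢b (x-y≡0⇒x≡y b′ b b′-b≡0)) closed Xa
    where
    closed : ∀ x → T (X x) → T (X (x +ₚ (b′ -ₚ b)))
    closed x Xx = subst (λ t → T (X t)) ([a-b]+c≡a+[c-b] x b b′)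
                    (decidable-stable (T? _) λ ¬X → none (x , b , b′ , Xx , Yb , Yb′ , ¬X))

  cauchy-davenport : ∀ X Y → 1 ≤ card X → 1 ≤ card Y → CauchyDavenportBound X Y
  cauchy-davenport X Y = by-size (card Y) X Y ≤-refl
    where
    by-size : ∀ s X Y → card Y ≤ s → 1 ≤ card X → 1 ≤ card Y → CauchyDavenportBound X Y
    by-size zero    X Y |Y|≤0 _ 1≤|Y| = ⊥-elim (<⇒≱ 1≤|Y| |Y|≤0)
    by-size (suc s) X Y |Y|≤s 1≤|X| 1≤|Y|
      with 1≤card⇒∃ Y 1≤|Y| | card Y ≤? 1 | P ≤? card X | dysonWitness? X Y
    ... | y , Yy | yes |Y|≤1 | _ | _ =
      inj₁ (≤-trans (+-monoʳ-≤ (card X) |Y|≤1) (≤-trans (≤-reflexive (+-comm (card X) 1)) (s≤s (card≤card-⊞ X Y Yy))))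
    ... | y , Yy | no _ | yes P≤|X| | _ = inj₂ (≤-trans P≤|X| (card≤card-⊞ X Y Yy))
    ... | _ | no |Y|≰1 | no P≰|X| | no none =
      ⊥-elim (P≰|X| (all⇒m≤card X (¬DysonWitness⇒all X Y 1≤|X| (≰⇒> |Y|≰1) none)))
    ... | _ | no _ | no _ | yes (a , b , b′ , Xa , Yb , Yb′ , ¬X) =
      bound-transfer (by-size s X′ Y′ (≤-pred (≤-trans |Y′|<|Y| |Y|≤s)) 1≤|X′| 1≤|Y′|)
      where
      open DysonTransform X Y (a -ₚ b)
      |Y′|<|Y| : card Y′ < card Y
      |Y′|<|Y| = card-Y′<card-Y Yb′ (λ X[b′+e] → ¬X (subst (λ t → T (X t)) (+ₚ-comm b′ (a -ₚ b)) X[b′+e]))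
      1≤|X′| : 1 ≤ card X′
      1≤|X′| = T⇒1≤card X′ a (from T-∨ (inj₁ Xa))
      1≤|Y′| : 1 ≤ card Y′
      1≤|Y′| = T⇒1≤card Y′ b (from T-∧ (Yb , subst (λ t → T (X t)) (sym (trans (+ₚ-comm b (a -ₚ b)) ([x-y]+y≡x a b))) Xa))

  cauchy-davenport₃ : ∀ X Y Z → 1 ≤ card X → 1 ≤ card Y → 1 ≤ card Z → P + 2 ≤ card X + card Y + card Z →
                      P ≤ card ((X ⊞ Y) ⊞ Z)
  cauchy-davenport₃ X Y Z 1≤|X| 1≤|Y| 1≤|Z| large
    with 1≤card⇒∃ Y 1≤|Y| | 1≤card⇒∃ Z 1≤|Z| | cauchy-davenport X Y 1≤|X| 1≤|Y|
  ... | _ | z , Zz | inj₂ P≤|X+Y| = ≤-trans P≤|X+Y| (card≤card-⊞ (X ⊞ Y) Z Zz)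
  ... | y , Yy | _ | inj₁ |X|+|Y|≤1+|X+Y|
    with cauchy-davenport (X ⊞ Y) Z (≤-trans 1≤|X| (card≤card-⊞ X Y Yy)) 1≤|Z|
  ...   | inj₂ P≤|X+Y+Z| = P≤|X+Y+Z|
  ...   | inj₁ |X+Y|+|Z|≤1+|X+Y+Z| = +-cancelʳ-≤ 2 P _ (begin
    P + 2                                    ≤⟨ large ⟩
    card X + card Y + card Z                 ≤⟨ +-monoˡ-≤ (card Z) |X|+|Y|≤1+|X+Y| ⟩
    suc (card (X ⊞ Y) + card Z)              ≤⟨ s≤s |X+Y|+|Z|≤1+|X+Y+Z| ⟩
    suc (suc (card ((X ⊞ Y) ⊞ Z)))           ≡⟨ +-comm 2 _ ⟩
    card ((X ⊞ Y) ⊞ Z) + 2                   ∎)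
    where open ≤-Reasoning

SumOfThree : ∀ {p} → Subset p → Fin p → Set
SumOfThree A x = ∃[ a₁ ] ∃[ a₂ ] ∃[ a₃ ] (a₁ ∈ A × a₂ ∈ A × a₃ ∈ A × a₁ ≢ a₂ × a₂ ≢ a₃ × a₁ +ₚ a₂ +ₚ a₃ ≡ x)

sum-of-three-𝔽₃ : (A : Subset 3) → 3 ≤ ∣ A ∣ → ∀ x → SumOfThree A x
sum-of-three-𝔽₃ A 3≤|A| = λ
  { 0F → 0F , 1F , 2F , ∈A 0F , ∈A 1F , ∈A 2F , (λ ()) , (λ ()) , refl
  ; 1F → 0F , 1F , 0F , ∈A 0F , ∈A 1F , ∈A 0F , (λ ()) , (λ ()) , refl
  ; 2F → 1F , 0F , 1F , ∈A 1F , ∈A 0F , ∈A 1F , (λ ()) , (λ ()) , refl }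
  where
  open Counting
  ∈A : ∀ z → z ∈ A
  ∈A z = lookup⇒∈ A z (m≤card⇒all (lookup A) (subst (3 ≤_) (∣A∣≡card A) 3≤|A|) z)

module ThreeSums (n : ℕ) (p-prime : Prime (suc n)) where

  open ZMod n
  open Counting
  open Sumset n p-prime

  triple : F → F
  triple u = u +ₚ u +ₚ u

  toℕ-triple : ∀ u → toℕ (triple u) ≡ (0 + 3 * toℕ u) % P
  toℕ-triple u = begin
    toℕ (u +ₚ u +ₚ u)                      ≡⟨ toℕ-+ₚ (u +ₚ u) u ⟩
    (toℕ (u +ₚ u) + toℕ u) % P             ≡⟨ cong (λ t → (t + toℕ u) % P) (toℕ-+ₚ u u) ⟩
    ((toℕ u + toℕ u) % P + toℕ u) % P      ≡⟨ [m%d+n]%d≡[m+n]%d (toℕ u + toℕ u) (toℕ u) P ⟩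
    (toℕ u + toℕ u + toℕ u) % P            ≡⟨ cong (_% P) (m+m+m≡3*m (toℕ u)) ⟩
    (3 * toℕ u) % P                        ∎
    where open ≡-Reasoning

  triple-collision⇒P≡3 : ∀ {u v} → toℕ u < toℕ v → triple u ≡ triple v → P ≡ 3
  triple-collision⇒P≡3 {u} {v} u<v eq = p∣3⇒p≡3 p-prime ([m+kx]%p≡[m+ky]%p⇒p∣k p-prime 0 3 u<v (toℕ<n v)
    (trans (sym (toℕ-triple u)) (trans (cong toℕ eq) (toℕ-triple v))))

  triple-injective : P ≢ 3 → ∀ {u v} → triple u ≡ triple v → u ≡ v
  triple-injective P≢3 {u} {v} eq with <-cmp (toℕ u) (toℕ v)
  ... | tri< u<v _ _ = ⊥-elim (P≢3 (triple-collision⇒P≡3 u<v eq))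
  ... | tri≈ _ u≡v _ = toℕ-injective u≡v
  ... | tri> _ _ v<u = ⊥-elim (P≢3 (triple-collision⇒P≡3 v<u (sym eq)))

  rearrange : (A : Subset P) {x : F} → ∀ u w c → u ∈ A → w ∈ A → c ∈ A → ¬ (u ≡ w × w ≡ c) →
              u +ₚ w +ₚ c ≡ x → SumOfThree A x
  rearrange A u w c u∈A w∈A c∈A not-constant sum≡x with u ≟ w | w ≟ c
  ... | no u≢w | no w≢c = u , w , c , u∈A , w∈A , c∈A , u≢w , w≢c , sum≡x
  ... | no u≢w | yes refl = w , u , w , w∈A , u∈A , w∈A , u≢w ∘ sym , u≢w , trans (cong (_+ₚ w) (+ₚ-comm w u)) sum≡x
  ... | yes refl | no w≢c = u , c , u , u∈A , c∈A , u∈A , w≢c , w≢c ∘ sym , trans (u+c+u≡u+u+c) sum≡x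
    where
    u+c+u≡u+u+c : u +ₚ c +ₚ u ≡ u +ₚ u +ₚ c
    u+c+u≡u+u+c = trans (+ₚ-assoc u c u) (trans (cong (u +ₚ_) (+ₚ-comm c u)) (sym (+ₚ-assoc u u c)))
  ... | yes refl | yes refl = ⊥-elim (not-constant (refl , refl))

  module _ (P≢3 : P ≢ 3) (A : Subset P) (large : P / 3 + 2 ≤ ∣ A ∣) (x : F) where

    Â A′ : F → Bool
    Â = lookup A
    A′ u = Â u ∧ not (⁅ x ⁆ (triple u))

    |A|≤1+|A′| : card Â ≤ suc (card A′)
    |A|≤1+|A′| = card≤1+card-∖ Â (λ u → ⁅ x ⁆ (triple u))
      λ u v 3u≡x 3v≡x → triple-injective P≢3 (trans (∈⁅⁆⇒≡ x _ 3u≡x) (sym (∈⁅⁆⇒≡ x _ 3v≡x)))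

    large′ : P / 3 + 2 ≤ card Â
    large′ = subst (P / 3 + 2 ≤_) (∣A∣≡card A) large

    1≤|A| : 1 ≤ card Â
    1≤|A| = ≤-trans (s≤s z≤n) (≤-trans (m≤n+m 2 (P / 3)) large′)

    1≤|A′| : 1 ≤ card A′
    1≤|A′| = ≤-pred (≤-trans (≤-trans (m≤n+m 2 (P / 3)) large′) |A|≤1+|A′|)

    x∈A′+A′+A : T (((A′ ⊞ A′) ⊞ Â) x)
    x∈A′+A′+A = m≤card⇒all _ (cauchy-davenport₃ A′ A′ Â 1≤|A′| 1≤|A′| 1≤|A|
                               (floor-third-bound P (card Â) (card A′) large′ |A|≤1+|A′|)) x

    sum-of-three : SumOfThree A x
    sum-of-three with ⊞-elim (A′ ⊞ A′) Â x∈A′+A′+A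
    ... | s , c , s∈A′+A′ , Âc , s+c≡x with ⊞-elim A′ A′ s∈A′+A′
    ...   | u , w , A′u , A′w , u+w≡s =
      rearrange A u w c (A′⊆A A′u) (A′⊆A A′w) (lookup⇒∈ A c Âc) not-constant (trans (cong (_+ₚ c) u+w≡s) s+c≡x)
      where
      A′⊆A : ∀ {z} → T (A′ z) → z ∈ A
      A′⊆A {z} A′z = lookup⇒∈ A z (proj₁ (to T-∧ A′z))
      not-constant : ¬ (u ≡ w × w ≡ c)
      not-constant (refl , refl) = ∉⁅⁆⇒≢ x (triple u) (proj₂ (to T-∧ A′u)) (trans (cong (_+ₚ u) u+w≡s) s+c≡x)

corollary1p1 : (p : ℕ) → Prime p → (A : Subset p) → (p / 3) + 2 ≤ ∣ A ∣ →
    (x : Fin p) → ∃[ a₁ ] ∃[ a₂ ] ∃[ a₃ ] (a₁ ∈ A × a₂ ∈ A × a₃ ∈ A × a₁ ≢ a₂ × a₂ ≢ a₃ × a₁ +ₚ a₂ +ₚ a₃ ≡ x)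
corollary1p1 zero    p-prime = ⊥-elim (¬prime[0] p-prime)
corollary1p1 (suc n) p-prime A large x with suc n ≟ℕ 3
... | yes refl = sum-of-three-𝔽₃ A large x
... | no  P≢3  = ThreeSums.sum-of-three n p-prime P≢3 A large x
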